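{- Let $\Gamma$ be a branching diagram and let $t=(v_0,v_1,\dots)$ be an infinite path in $\Gamma$ such that $d(\varnothing,t)<\infty$ (equivalently, all but finitely many $v_n$ have a single immediate predecessor). Then $\varphi_t(v)=d(v,t)/d(\varnothing,t)$, $v\in\Gamma$, is a nonnegative harmonic function on $\Gamma$ with $\varphi_t(\varnothing)=1$.
   Context: A branching diagram is a graded poset $\Gamma=\bigsqcup_{n\ge0}\Gamma_n$ with each $\Gamma_n$ finite, unique minimal element $\varnothing\in\Gamma_0$ and no maximal elements; $u\nearrow w$ is the covering relation. $d(u,v)$ is the number of saturated chains from $u$ to $v$. An infinite path is $t=(v_0,v_1,\dots)$ with $v_0=\varnothing$, $v_n\in\Gamma_n$, $v_{n-1}\nearrow v_n$; $d(u,t)=\lim_n d(u,v_n)$. A function $\varphi:\Gamma\to\mathbb R$ is harmonic if $\varphi(u)=\sum_{w:u\nearrow w}\varphi(w)$ for all $u\in\Gamma$. -}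

module Defs where

open import Data.Nat using (ℕ; zero; suc; _≤_; _≡ᵇ_; _≤ᵇ_; NonZero)
open import Data.Nat as ℕ using ()
open import Data.Bool using (Bool; true; false; if_then_else_; _∧_)
open import Data.Fin using (Fin; toℕ)
open import Data.List using (List; map; sum; allFin)
open import Data.Product using (Σ; ∃; _×_; _,_)
open import Data.Integer using (+_)
open import Data.Rational as ℚ using (ℚ)
open import Relation.Binary.PropositionalEquality using (_≡_)

Σfin : {A : Set} → (A → A → A) → A → (n : ℕ) → (Fin n → A) → A
Σfin _+_ z n f = Data.List.foldr _+_ z (map f (allFin n))

-- A branching diagram: level Γ_n is Fin (size n); the covering relation
-- u ↗ w (u ∈ Γ_n, w ∈ Γ_{n+1}) is the Boolean relation cov n u w.
-- The graded poset is the reflexive-transitive closure of cov.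
record BranchingDiagram : Set where
  field
    size : ℕ → ℕ
    cov  : (n : ℕ) → Fin (size n) → Fin (size (suc n)) → Bool
    root      : Fin (size 0)
    root-uniq : (x : Fin (size 0)) → x ≡ root
    -- every vertex of positive level has an immediate predecessor
    -- (otherwise it would be another minimal element)
    has-pred  : (n : ℕ) (w : Fin (size (suc n))) → ∃ λ u → cov n u w ≡ true
    has-succ  : (n : ℕ) (u : Fin (size n)) → ∃ λ w → cov n u w ≡ true

module _ (Γ : BranchingDiagram) where
  open BranchingDiagram Γ

  Vertex : Set
  Vertex = Σ ℕ (λ n → Fin (size n))

  -- number of saturated chains from u ∈ Γ_k to v ∈ Γ_m (0 if no chain)
  chains : (k : ℕ) → Fin (size k) → (m : ℕ) → Fin (size m) → ℕ
  chains k u zero v = if (k ≡ᵇ 0) ∧ (toℕ u ≡ᵇ toℕ v) then 1 else 0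
  chains k u (suc m) v =
    if k ≡ᵇ suc m then (if toℕ u ≡ᵇ toℕ v then 1 else 0)
    else (if k ≤ᵇ m
          then Σfin ℕ._+_ 0 (size m) (λ w → if cov m w v then chains k u m w else 0)
          else 0)

  d : Vertex → Vertex → ℕ
  d (k , u) (m , v) = chains k u m v

  ∅ : Vertex
  ∅ = (0 , root)

  record InfinitePath : Set where
    field
      vtx  : (n : ℕ) → Fin (size n)
      start : vtx 0 ≡ root
      step : (n : ℕ) → cov n (vtx n) (vtx (suc n)) ≡ true

  -- limit of a sequence of natural numbers equal to a (finite) value L:
  -- for ℕ-valued sequences, convergence to L means eventually equal to L.
  LimEq : (ℕ → ℕ) → ℕ → Set
  LimEq a L = ∃ λ N → (n : ℕ) → N ≤ n → a n ≡ L

  dPath≡ : Vertex → InfinitePath → ℕ → Set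
  dPath≡ u t L = LimEq (λ n → d u (n , InfinitePath.vtx t n)) L

  Harmonic : (Vertex → ℚ) → Set
  Harmonic φ = (n : ℕ) (u : Fin (size n)) →
    φ (n , u) ≡ Σfin ℚ._+_ ℚ.0ℚ (size (suc n))
                  (λ w → if cov n u w then φ (suc n , w) else ℚ.0ℚ)

{-# OPTIONS --safe #-}
-- Every vertex is reachable from ∅, so d(∅, v_{n+1}) ≥ d(∅, v_n), with equality exactly when
-- v_n is the only immediate predecessor of v_{n+1}.  Hence d(∅, t) = L forces single
-- predecessors from some level N on, and then d(v, v_n) is constant for n ≥ N + |v|: this
-- constant is d(v, t).  Harmonicity of d(·, t) is the first-step decomposition
-- d(u, v) = Σ_{u ↗ w} d(w, v) of chain counts, read at a level where all terms have
-- stabilised; L > 0 because ∅ reaches v_N, and dividing by L gives φ_t(∅) = 1.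
module Submission where

open import Defs

module FiniteSums where

  open import Data.Bool using (Bool; true; false; if_then_else_)
  open import Data.Bool.Properties using (if-cong-then; if-eta)
  open import Data.Fin using (Fin; zero; suc; punchOut)
  open import Data.Fin.Properties using (punchIn-punchOut; punchInᵢ≢i)
  import Data.List as List
  open import Data.List.Properties using (map-tabulate)
  open import Data.Nat using (ℕ; zero; suc; _+_; _≤_)
  open import Data.Nat.Properties
    using (+-0-commutativeMonoid; +-identityʳ; +-monoʳ-≤; m≤m+n; ≤-trans; ≤-reflexive; module ≤-Reasoning)
  open import Data.Vec.Functional as Vector using (Vector; removeAt)
  open import Function using (_∘_; id)
  open import Relation.Binary.PropositionalEquality

  open import Algebra.Properties.CommutativeMonoid.Sum +-0-commutativeMonoid public
    using (sum; sum-remove; sum-cong-≗; sum-replicate-zero; ∑-comm)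

  Σfin-foldr : {A : Set} (_∙_ : A → A → A) (ε : A) (n : ℕ) (f : Fin n → A) →
               Σfin _∙_ ε n f ≡ Vector.foldr _∙_ ε f
  Σfin-foldr _∙_ ε n f = trans (cong (List.foldr _∙_ ε) (map-tabulate id f)) (foldr-tabulate n f)
    where
    foldr-tabulate : ∀ n (f : Fin n → _) → List.foldr _∙_ ε (List.tabulate f) ≡ Vector.foldr _∙_ ε f
    foldr-tabulate zero    f = refl
    foldr-tabulate (suc n) f = cong (f zero ∙_) (foldr-tabulate n (f ∘ suc))

  foldr-homo : {A B : Set} (h : A → B) {_∙_ : A → A → A} {_∙′_ : B → B → B} {ε : A} {ε′ : B} →
               h ε ≡ ε′ → (∀ x y → h (x ∙ y) ≡ h x ∙′ h y) →
               ∀ {n} (f : Vector A n) (g : Vector B n) → (∀ i → h (f i) ≡ g i) →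
               h (Vector.foldr _∙_ ε f) ≡ Vector.foldr _∙′_ ε′ g
  foldr-homo h ε-homo ∙-homo {zero}  f g h∘f≗g = ε-homo
  foldr-homo h {_∙′_ = _∙′_} ε-homo ∙-homo {suc n} f g h∘f≗g =
    trans (∙-homo _ _)
          (cong₂ _∙′_ (h∘f≗g zero) (foldr-homo h ε-homo ∙-homo (f ∘ suc) (g ∘ suc) (h∘f≗g ∘ suc)))

  term≤sum : ∀ {n} (f : Vector ℕ n) i → f i ≤ sum f
  term≤sum {suc n} f i = ≤-trans (m≤m+n (f i) _) (≤-reflexive (sym (sum-remove f)))

  term+term≤sum : ∀ {n} (f : Vector ℕ n) {i j} → i ≢ j → f i + f j ≤ sum f
  term+term≤sum {suc n} f {i} {j} i≢j = begin
    f i + f j                         ≡⟨ cong (λ k → f i + f k) (punchIn-punchOut i≢j) ⟨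
    f i + removeAt f i (punchOut i≢j) ≤⟨ +-monoʳ-≤ (f i) (term≤sum (removeAt f i) (punchOut i≢j)) ⟩
    f i + sum (removeAt f i)          ≡⟨ sum-remove f ⟨
    sum f                             ∎
    where open ≤-Reasoning

  sum-single : ∀ {n} (f : Vector ℕ n) i → (∀ j → j ≢ i → f j ≡ 0) → sum f ≡ f i
  sum-single {suc n} f i others = begin
    sum f                    ≡⟨ sum-remove f ⟩
    f i + sum (removeAt f i) ≡⟨ cong (_+_ (f i)) (sum-cong-≗ (others _ ∘ punchInᵢ≢i i)) ⟩
    f i + sum {n} (λ _ → 0)  ≡⟨ cong (_+_ (f i)) (sum-replicate-zero n) ⟩
    f i + 0                  ≡⟨ +-identityʳ (f i) ⟩
    f i                      ∎
    where open ≡-Reasoning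

  if-then-0 : ∀ c {x : ℕ} → x ≡ 0 → (if c then x else 0) ≡ 0
  if-then-0 c x≡0 = trans (if-cong-then c x≡0) (if-eta c)

  sum-if : ∀ {n} (c : Bool) (f : Vector ℕ n) → sum (λ j → if c then f j else 0) ≡ (if c then sum f else 0)
  sum-if     true  f = refl
  sum-if {n} false f = sum-replicate-zero n

module Sequences where

  open import Data.Nat using (ℕ; suc; _≤_; _≤′_; ≤′-refl; ≤′-step)
  open import Data.Nat.Properties using (≤⇒≤′; ≤′⇒≤)
  open import Relation.Binary.PropositionalEquality using (_≡_; refl; trans)

  eventually-constant : {A : Set} (a : ℕ → A) (M : ℕ) → (∀ n → M ≤ n → a (suc n) ≡ a n) →
                        ∀ n → M ≤ n → a n ≡ a M
  eventually-constant a M step n M≤n = go (≤⇒≤′ M≤n)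
    where
    go : ∀ {n} → M ≤′ n → a n ≡ a M
    go ≤′-refl            = refl
    go (≤′-step {n} M≤′n) = trans (step n (≤′⇒≤ M≤′n)) (go M≤′n)

module Chains (Γ : BranchingDiagram) where

  open BranchingDiagram Γ
  open FiniteSums
  open import Data.Bool using (if_then_else_)
  open import Data.Bool.Properties using (if-cong; if-cong-then; if-swap-then)
  open import Data.Fin using (Fin; toℕ)
  open import Data.Fin.Properties using (toℕ-injective)
  open import Data.Nat using (ℕ; zero; suc; _+_; _≤_; _<_; _≡ᵇ_; z≤n; s≤s)
  open import Data.Nat.Properties
    using (_≟_; _≤?_; ≤-refl; ≤-reflexive; <⇒≢; m≤n⇒m<n∨m≡n; module ≤-Reasoning)
  open import Data.Product using (_,_)
  open import Data.Sum using (inj₁; inj₂)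
  open import Function using (_∘_)
  open import Relation.Nullary.Decidable using (dec-true; dec-false)
  open import Relation.Binary.PropositionalEquality

  Harmonicℕ : (Vertex Γ → ℕ) → Set
  Harmonicℕ D = ∀ n (u : Fin (size n)) → D (n , u) ≡ sum (λ w → if cov n u w then D (suc n , w) else 0)

  chains-diag : ∀ k (u w : Fin (size k)) → chains Γ k u k w ≡ (if toℕ u ≡ᵇ toℕ w then 1 else 0)
  chains-diag zero    u w = refl
  chains-diag (suc k) u w = if-cong (dec-true (k ≟ k) refl)

  chains-refl : ∀ k (u : Fin (size k)) → chains Γ k u k u ≡ 1
  chains-refl k u = trans (chains-diag k u u) (if-cong (dec-true (toℕ u ≟ toℕ u) refl))

  chains-≢ : ∀ k {u w : Fin (size k)} → w ≢ u → chains Γ k u k w ≡ 0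
  chains-≢ k {u} {w} w≢u =
    trans (chains-diag k u w) (if-cong (dec-false (toℕ u ≟ toℕ w) (w≢u ∘ sym ∘ toℕ-injective)))

  chains-last-step : ∀ {k} (u : Fin (size k)) {m} (v : Fin (size (suc m))) → k ≤ m →
    chains Γ k u (suc m) v ≡ sum (λ w → if cov m w v then chains Γ k u m w else 0)
  chains-last-step {k} u {m} v k≤m =
    trans (if-cong (dec-false (k ≟ suc m) (<⇒≢ (s≤s k≤m))))
          (trans (if-cong (dec-true (k ≤? m) k≤m)) (Σfin-foldr _+_ 0 (size m) _))

  chains-first-step : ∀ {k} (u : Fin (size k)) {m} (v : Fin (size m)) → k < m →
    chains Γ k u m v ≡ sum (λ w → if cov k u w then chains Γ (suc k) w m v else 0)
  chains-first-step {k} u {suc m} v (s≤s k≤m) with m≤n⇒m<n∨m≡n k≤m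
  ... | inj₂ refl = begin
    chains Γ k u (suc k) v
      ≡⟨ chains-last-step u v ≤-refl ⟩
    sum (λ w → if cov k w v then chains Γ k u k w else 0)
      ≡⟨ sum-single (λ w → if cov k w v then chains Γ k u k w else 0) u
           (λ w w≢u → if-then-0 (cov k w v) (chains-≢ k w≢u)) ⟩
    (if cov k u v then chains Γ k u k u else 0)
      ≡⟨ if-cong-then (cov k u v) (trans (chains-refl k u) (sym (chains-refl (suc k) v))) ⟩
    (if cov k u v then chains Γ (suc k) v (suc k) v else 0)
      ≡⟨ sum-single (λ w → if cov k u w then chains Γ (suc k) w (suc k) v else 0) v
           (λ w w≢v → if-then-0 (cov k u w) (chains-≢ (suc k) (w≢v ∘ sym))) ⟨
    sum (λ w → if cov k u w then chains Γ (suc k) w (suc k) v else 0) ∎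
    where open ≡-Reasoning
  ... | inj₁ k<m = begin
    chains Γ k u (suc m) v
      ≡⟨ chains-last-step u v k≤m ⟩
    sum (λ x → if cov m x v then chains Γ k u m x else 0)
      ≡⟨ sum-cong-≗ (λ x → if-cong-then (cov m x v) (chains-first-step u x k<m)) ⟩
    sum (λ x → if cov m x v then sum (λ w → if cov k u w then chains Γ (suc k) w m x else 0) else 0)
      ≡⟨ sum-cong-≗ (λ x → sum-if (cov m x v) (λ w → if cov k u w then chains Γ (suc k) w m x else 0)) ⟨
    sum (λ x → sum (λ w → if cov m x v then (if cov k u w then chains Γ (suc k) w m x else 0) else 0))
      ≡⟨ ∑-comm (λ x w → if cov m x v then (if cov k u w then chains Γ (suc k) w m x else 0) else 0) ⟩
    sum (λ w → sum (λ x → if cov m x v then (if cov k u w then chains Γ (suc k) w m x else 0) else 0))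
      ≡⟨ sum-cong-≗ (λ w → sum-cong-≗ (λ x → if-swap-then (cov m x v) (cov k u w))) ⟩
    sum (λ w → sum (λ x → if cov k u w then (if cov m x v then chains Γ (suc k) w m x else 0) else 0))
      ≡⟨ sum-cong-≗ (λ w → sum-if (cov k u w) (λ x → if cov m x v then chains Γ (suc k) w m x else 0)) ⟩
    sum (λ w → if cov k u w then sum (λ x → if cov m x v then chains Γ (suc k) w m x else 0) else 0)
      ≡⟨ sum-cong-≗ (λ w → if-cong-then (cov k u w) (chains-last-step w v k<m)) ⟨
    sum (λ w → if cov k u w then chains Γ (suc k) w (suc m) v else 0) ∎
    where open ≡-Reasoning

  chains-from-root-positive : ∀ n (v : Fin (size n)) → 0 < chains Γ 0 root n v
  chains-from-root-positive zero    v rewrite root-uniq v = ≤-reflexive (sym (chains-refl 0 root))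
  chains-from-root-positive (suc n) v with has-pred n v
  ... | u , u↗v = begin-strict
    0                         <⟨ chains-from-root-positive n u ⟩
    chains Γ 0 root n u       ≡⟨ if-cong u↗v ⟨
    f u                       ≤⟨ term≤sum f u ⟩
    sum f                     ≡⟨ chains-last-step root v z≤n ⟨
    chains Γ 0 root (suc n) v ∎
    where
    open ≤-Reasoning
    f : Fin (size n) → ℕ
    f w = if cov n w v then chains Γ 0 root n w else 0

module Paths (Γ : BranchingDiagram) (t : InfinitePath Γ) where

  open BranchingDiagram Γ
  open InfinitePath t
  open FiniteSums
  open Chains Γ
  open Sequences using (eventually-constant)
  open import Data.Bool using (true; false; if_then_else_)
  open import Data.Bool.Properties using (if-cong; ¬-not)
  open import Data.Fin using (Fin) renaming (_≟_ to _≟ᶠ_)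
  open import Data.Nat using (ℕ; suc; _+_; _⊔_; _≤_; _<_; z≤n; NonZero; >-nonZero)
  open import Data.Nat.Properties
    using (≤-refl; <-irrefl; +-monoʳ-≤; n≤1+n; m≤n+m; m<m+n; m≤n⇒m≤1+n; m+n≤o⇒m≤o; m+n≤o⇒n≤o;
           m≤m⊔n; m≤n⊔m; module ≤-Reasoning)
  open import Data.Product using (Σ; ∃; _,_; proj₂)
  open import Function using (_∘_)
  open import Relation.Nullary using (yes; no; contradiction)
  open import Relation.Binary.PropositionalEquality

  SinglePredecessor : ℕ → Set
  SinglePredecessor n = ∀ w → cov n w (vtx (suc n)) ≡ true → w ≡ vtx n

  EventuallySinglePredecessor : Set
  EventuallySinglePredecessor = ∃ λ N → ∀ n → N ≤ n → SinglePredecessor n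

  LimEq-unique : ∀ {a : ℕ → ℕ} {L L′} → LimEq Γ a L → LimEq Γ a L′ → L ≡ L′
  LimEq-unique (N , a→L) (N′ , a→L′) =
    trans (sym (a→L (N ⊔ N′) (m≤m⊔n N N′))) (a→L′ (N ⊔ N′) (m≤n⊔m N N′))

  chains-from-root-constant⇒singlePredecessor : ∀ n →
    chains Γ 0 root (suc n) (vtx (suc n)) ≡ chains Γ 0 root n (vtx n) → SinglePredecessor n
  chains-from-root-constant⇒singlePredecessor n constant w w↗ with w ≟ᶠ vtx n
  ... | yes w≡vₙ = w≡vₙ
  ... | no  w≢vₙ = contradiction (begin-strict
    chains Γ 0 root n (vtx n)                       <⟨ m<m+n _ (chains-from-root-positive n w) ⟩
    chains Γ 0 root n (vtx n) + chains Γ 0 root n w ≡⟨ cong₂ _+_ (if-cong (step n)) (if-cong w↗) ⟨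
    f (vtx n) + f w                                 ≤⟨ term+term≤sum f (w≢vₙ ∘ sym) ⟩
    sum f                                           ≡⟨ chains-last-step root (vtx (suc n)) z≤n ⟨
    chains Γ 0 root (suc n) (vtx (suc n))           ≡⟨ constant ⟩
    chains Γ 0 root n (vtx n)                       ∎) (<-irrefl refl)
    where
    open ≤-Reasoning
    f : Fin (size n) → ℕ
    f x = if cov n x (vtx (suc n)) then chains Γ 0 root n x else 0

  singlePredecessor⇒chains-constant : ∀ {k} (u : Fin (size k)) {n} → SinglePredecessor n → k ≤ n →
    chains Γ k u (suc n) (vtx (suc n)) ≡ chains Γ k u n (vtx n)
  singlePredecessor⇒chains-constant {k} u {n} single k≤n = begin
    chains Γ k u (suc n) (vtx (suc n)) ≡⟨ chains-last-step u (vtx (suc n)) k≤n ⟩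
    sum f                              ≡⟨ sum-single f (vtx n) (λ w → if-cong ∘ not-predecessor) ⟩
    f (vtx n)                          ≡⟨ if-cong (step n) ⟩
    chains Γ k u n (vtx n)             ∎
    where
    open ≡-Reasoning
    f : Fin (size n) → ℕ
    f x = if cov n x (vtx (suc n)) then chains Γ k u n x else 0
    not-predecessor : ∀ {w} → w ≢ vtx n → cov n w (vtx (suc n)) ≡ false
    not-predecessor w≢vₙ = ¬-not (w≢vₙ ∘ single _)

  module _ {L : ℕ} (d∅t≡L : dPath≡ Γ (∅ Γ) t L) where

    open Σ d∅t≡L renaming (proj₁ to N; proj₂ to d∅vₙ≡L)

    d∅t-nonZero : NonZero L
    d∅t-nonZero = >-nonZero (subst (0 <_) (d∅vₙ≡L N ≤-refl) (chains-from-root-positive N (vtx N)))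

    d∅t-finite⇒eventuallySinglePredecessor : EventuallySinglePredecessor
    d∅t-finite⇒eventuallySinglePredecessor = N , λ n N≤n →
      chains-from-root-constant⇒singlePredecessor n (trans (d∅vₙ≡L (suc n) (m≤n⇒m≤1+n N≤n)) (sym (d∅vₙ≡L n N≤n)))

  module Limit (eventually-single : EventuallySinglePredecessor) where

    open Σ eventually-single renaming (proj₁ to N; proj₂ to single)

    dₜ : Vertex Γ → ℕ
    dₜ (k , u) = chains Γ k u (N + k) (vtx (N + k))

    dₜ-limit : (v : Vertex Γ) → dPath≡ Γ v t (dₜ v)
    dₜ-limit (k , u) = N + k , eventually-constant (λ n → chains Γ k u n (vtx n)) (N + k) λ n N+k≤n →
      singlePredecessor⇒chains-constant u (single n (m+n≤o⇒m≤o N N+k≤n)) (m+n≤o⇒n≤o N N+k≤n)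

    dₜ-harmonic : Harmonicℕ dₜ
    dₜ-harmonic n u = trans (sym (proj₂ (dₜ-limit (n , u)) (N + suc n) (+-monoʳ-≤ N (n≤1+n n))))
                            (chains-first-step u (vtx (N + suc n)) (m≤n+m (suc n) N))

module Fractions where

  open FiniteSums using (sum; Σfin-foldr; foldr-homo)
  open Chains using (Harmonicℕ)
  open import Data.Bool using (if_then_else_)
  open import Data.Bool.Properties using (if-float; if-cong-else)
  open import Data.Integer as ℤ using (+_)
  import Data.Integer.Properties as ℤ
  open import Data.Nat using (ℕ; suc; _+_; NonZero)
  open import Data.Product using (_,_)
  open import Data.Rational as ℚ using (_/_; 0ℚ; 1ℚ; fromℚᵘ; toℚᵘ)
  open import Data.Rational.Properties
    using (fromℚᵘ-cong; fromℚᵘ-toℚᵘ; toℚᵘ-fromℚᵘ; toℚᵘ-homo-+; 0/n≡0; nonNegative⁻¹; normalize-nonNeg)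
  import Data.Rational.Unnormalised as ℚᵘ
  import Data.Rational.Unnormalised.Properties as ℚᵘ
  import Data.Vec.Functional as Vector
  open import Relation.Binary.PropositionalEquality

  fromℚᵘ-homo-+ : ∀ p q → fromℚᵘ (p ℚᵘ.+ q) ≡ fromℚᵘ p ℚ.+ fromℚᵘ q
  fromℚᵘ-homo-+ p q = begin
    fromℚᵘ (p ℚᵘ.+ q)                             ≡⟨ fromℚᵘ-cong (ℚᵘ.+-cong (toℚᵘ-fromℚᵘ p) (toℚᵘ-fromℚᵘ q)) ⟨
    fromℚᵘ (toℚᵘ (fromℚᵘ p) ℚᵘ.+ toℚᵘ (fromℚᵘ q)) ≡⟨ fromℚᵘ-cong (toℚᵘ-homo-+ (fromℚᵘ p) (fromℚᵘ q)) ⟨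
    fromℚᵘ (toℚᵘ (fromℚᵘ p ℚ.+ fromℚᵘ q))         ≡⟨ fromℚᵘ-toℚᵘ (fromℚᵘ p ℚ.+ fromℚᵘ q) ⟩
    fromℚᵘ p ℚ.+ fromℚᵘ q                         ∎
    where open ≡-Reasoning

  -- By definition + m / suc k is fromℚᵘ (+ m ℚᵘ./ suc k), so additivity can be checked on
  -- unnormalised fractions.
  /-distribʳ-+ : ∀ m n d .{{_ : NonZero d}} → + (m + n) / d ≡ + m / d ℚ.+ + n / d
  /-distribʳ-+ m n (suc d-1) = trans
    (fromℚᵘ-cong {+ (m + n) ℚᵘ./ suc d-1} {+ m ℚᵘ./ suc d-1 ℚᵘ.+ + n ℚᵘ./ suc d-1} (ℚᵘ.*≡* cross))
    (fromℚᵘ-homo-+ (+ m ℚᵘ./ suc d-1) (+ n ℚᵘ./ suc d-1))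
    where
    open ≡-Reasoning
    cross : ∀ {q} → + (m + n) ℤ.* (q ℤ.* q) ≡ (+ m ℤ.* q ℤ.+ + n ℤ.* q) ℤ.* q
    cross {q} = begin
      + (m + n) ℤ.* (q ℤ.* q)         ≡⟨ cong (ℤ._* (q ℤ.* q)) (ℤ.pos-+ m n) ⟩
      (+ m ℤ.+ + n) ℤ.* (q ℤ.* q)     ≡⟨ ℤ.*-assoc (+ m ℤ.+ + n) q q ⟨
      (+ m ℤ.+ + n) ℤ.* q ℤ.* q       ≡⟨ cong (ℤ._* q) (ℤ.*-distribʳ-+ q (+ m) (+ n)) ⟩
      (+ m ℤ.* q ℤ.+ + n ℤ.* q) ℤ.* q ∎

  n/n≡1 : ∀ n .{{_ : NonZero n}} → + n / n ≡ 1ℚ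
  n/n≡1 (suc n-1) = fromℚᵘ-cong {+ suc n-1 ℚᵘ./ suc n-1} {ℚᵘ.1ℚᵘ} (ℚᵘ.*≡* (ℤ.*-comm (+ suc n-1) (+ 1)))

  0≤n/d : ∀ n d .{{_ : NonZero d}} → 0ℚ ℚ.≤ + n / d
  0≤n/d n d = nonNegative⁻¹ (+ n / d) {{normalize-nonNeg n d}}

  /-harmonic : (Γ : BranchingDiagram) (D : Vertex Γ → ℕ) (L : ℕ) .{{_ : NonZero L}} →
               Harmonicℕ Γ D → Harmonic Γ (λ v → + D v / L)
  /-harmonic Γ D L D-harmonic n u = begin
    + D (n , u) / L
      ≡⟨ cong (λ x → + x / L) (D-harmonic n u) ⟩
    + sum (λ w → if cov n u w then D (suc n , w) else 0) / L
      ≡⟨ foldr-homo (λ x → + x / L) (0/n≡0 L) (λ a b → /-distribʳ-+ a b L) _ _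
           (λ w → trans (if-float (λ x → + x / L) (cov n u w)) (if-cong-else (cov n u w) (0/n≡0 L))) ⟩
    Vector.foldr ℚ._+_ 0ℚ (λ w → if cov n u w then + D (suc n , w) / L else 0ℚ)
      ≡⟨ Σfin-foldr ℚ._+_ 0ℚ (size (suc n)) _ ⟨
    Σfin ℚ._+_ 0ℚ (size (suc n)) (λ w → if cov n u w then + D (suc n , w) / L else 0ℚ) ∎
    where
    open BranchingDiagram Γ
    open ≡-Reasoning

open import Data.Nat using (ℕ; NonZero)
open import Data.Product using (Σ; _×_; _,_)
open import Data.Integer using (+_)
open import Data.Rational using (ℚ; _/_; 0ℚ; 1ℚ; _≤_)
open import Relation.Binary.PropositionalEquality using (_≡_; cong; trans)
open Fractions using (0≤n/d; n/n≡1; /-harmonic)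

proposition4p2 :
    (Γ : BranchingDiagram) (t : InfinitePath Γ) (L : ℕ) →
    dPath≡ Γ (∅ Γ) t L →
    Σ (NonZero L) λ nz →
    Σ (Vertex Γ → ℕ) λ D →
      ((v : Vertex Γ) → dPath≡ Γ v t (D v)) ×
      (let φ : Vertex Γ → ℚ
           φ v = _/_ (+ D v) L {{nz}}
       in ((v : Vertex Γ) → 0ℚ ≤ φ v) × Harmonic Γ φ × (φ (∅ Γ) ≡ 1ℚ))
proposition4p2 Γ t L d∅t≡L =
  L≢0 , dₜ , dₜ-limit , (λ v → 0≤n/d (dₜ v) L) , /-harmonic Γ dₜ L dₜ-harmonic , normalised
  where
  open Paths Γ t
  open Limit (d∅t-finite⇒eventuallySinglePredecessor d∅t≡L)

  instance
    L≢0 : NonZero L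
    L≢0 = d∅t-nonZero d∅t≡L

  normalised : + dₜ (∅ Γ) / L ≡ 1ℚ
  normalised = trans (cong (λ x → + x / L) (LimEq-unique (dₜ-limit (∅ Γ)) d∅t≡L)) (n/n≡1 L)
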